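{- Let $n$ be a positive integer and $p$ a prime with $p^p\mid n$, and let $0\le r<p$ be the remainder when $\tau(n)$ is divided by $p$. If $\tau(n)>r(p+1)$, then $n$ is not matchable.
   Context: For a positive integer $n$, let $D(n)$ be its set of positive divisors and $\tau(n)=|D(n)|$. A coprime matching between two finite sets of integers of the same cardinality is a bijection $\psi$ between them such that $\gcd(x,\psi(x))=1$ for every $x$ in the domain. A positive integer $n$ is called matchable if there is a coprime matching between $\{1,2,\dots,\tau(n)\}$ and $D(n)$. -}

module Defs where

open import Data.Nat using (ℕ; zero; suc; _+_; NonZero)
open import Data.Nat.Divisibility using (_∣?_)
open import Data.Nat.GCD using (gcd)
open import Data.List using (List; filter; length; lookup; applyUpTo)
open import Data.Fin using (Fin; toℕ)
open import Data.Product using (Σ)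
open import Function.Bundles using (_↔_; Inverse)
open import Relation.Binary.PropositionalEquality using (_≡_)

divisors : ℕ → List ℕ
divisors n = filter (_∣? n) (applyUpTo suc n)

τ : ℕ → ℕ
τ n = length (divisors n)

-- n is matchable: there is a bijection ψ from {1,…,τ(n)} onto D(n)
-- with gcd(x, ψ(x)) = 1.  Elements of {1,…,τ(n)} are represented by
-- i : Fin (τ n) standing for toℕ i + 1; elements of D(n) by positions in
-- the (duplicate-free) list divisors n.  A bijection between the two sets
-- is thus a bijection Fin (τ n) ↔ Fin (τ n).
Matchable : ℕ → Set
Matchable n =
  Σ (Fin (τ n) ↔ Fin (τ n)) λ ψ →
    ∀ (i : Fin (τ n)) →
      gcd (suc (toℕ i)) (lookup (divisors n) (Inverse.to ψ i)) ≡ 1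

{-# OPTIONS --safe #-}
-- Among 1, …, τ(n) lie q = ⌊τ(n)/p⌋ multiples of p, and a coprime matching sends them to
-- q distinct divisors d₁, …, d_q of n that are prime to p.  As p^p ∣ n, each dₖ · p^e with
-- 0 ≤ e ≤ p divides n too, and these q(p+1) divisors are pairwise distinct by unique
-- factorisation.  Writing τ(n) = qp + r, this gives q(p+1) ≤ qp + r, so q ≤ r and
-- τ(n) ≤ r(p+1).
module Submission where

open import Defs
open import Data.Nat using (ℕ; _*_; _^_; _<_; _>_; _%_; suc; NonZero)
open import Data.Nat.Divisibility using (_∣_)
open import Data.Nat.Primality using (Prime)
open import Relation.Nullary using (¬_)

open import Data.Nat using (zero; _+_; _≤_; _∸_; pred; _/_; >-nonZero; ≢-nonZero⁻¹)
open import Data.Nat.Properties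
open import Algebra.Properties.CommutativeSemigroup *-commutativeSemigroup using (x∙yz≈y∙xz)
open import Data.Nat.Divisibility
  using (_∤_; _∣?_; divides; ∣-trans; m∣m*n; n∣m*n; *-cancelˡ-∣; *-monoʳ-∣; 1∣_; 0∣⇒≡0; ∣⇒≤)
open import Data.Nat.DivMod using (m≡m%n+[m/n]*n; m/n*n≤m)
open import Data.Nat.Coprimality using (gcd≡1⇒coprime)
open import Data.Nat.Primality using (euclidsLemma; prime⇒nonZero; ¬prime[1])
open import Data.List using (List; lookup; applyUpTo)
import Data.List.Relation.Unary.All as All
import Data.List.Relation.Unary.Any as Any
open import Data.List.Relation.Unary.Any.Properties using (lookup-index)
open import Data.List.Relation.Unary.AllPairs using (_∷_)
open import Data.List.Relation.Unary.Unique.Propositional using (Unique)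
open import Data.List.Relation.Unary.Unique.Propositional.Properties using (filter⁺; applyUpTo⁺₁)
open import Data.List.Membership.Propositional using (_∈_)
open import Data.List.Membership.Propositional.Properties
  using (∈-lookup; ∈-filter⁻; ∈-filter⁺; ∈-applyUpTo⁺)
open import Data.Fin as Fin using (Fin; toℕ; fromℕ<)
open import Data.Fin.Properties using (toℕ-injective; toℕ-fromℕ<; toℕ<n; injective⇒≤; *↔×)
open import Data.Product using (Σ; _,_; _×_; proj₂)
open import Data.Sum using (inj₁; inj₂)
open import Function using (_∘_)
open import Function.Bundles using (Inverse; Injection; _↔_)
open import Function.Definitions using (Injective)
open import Function.Properties.Inverse using (Inverse⇒Injection)
open import Relation.Binary.PropositionalEquality
open import Relation.Nullary using (contradiction)

private
  variable
    d e f m n p : ℕ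

↔-injective : ∀ {a b} {A : Set a} {B : Set b} (ψ : A ↔ B) → Injective _≡_ _≡_ (Inverse.to ψ)
↔-injective ψ = Injection.injective (Inverse⇒Injection ψ)

m≤n⇒p^m∣p^n : ∀ p → m ≤ n → p ^ m ∣ p ^ n
m≤n⇒p^m∣p^n {m} {n} p m≤n = divides (p ^ (n ∸ m)) (begin
  p ^ n                  ≡⟨ cong (p ^_) (m+[n∸m]≡n m≤n) ⟨
  p ^ (m + (n ∸ m))      ≡⟨ ^-distribˡ-+-* p m (n ∸ m) ⟩
  p ^ m * p ^ (n ∸ m)    ≡⟨ *-comm (p ^ m) _ ⟩
  p ^ (n ∸ m) * p ^ m    ∎)
  where open ≡-Reasoning

p∤m⇒p^e∣m*n⇒p^e∣n : Prime p → p ∤ m → p ^ e ∣ m * n → p ^ e ∣ n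
p∤m⇒p^e∣m*n⇒p^e∣n {e = zero} {n = n} _ _ _ = 1∣ n
p∤m⇒p^e∣m*n⇒p^e∣n {p} {m} {suc e} pr p∤m p^[1+e]∣m*n
  with euclidsLemma m _ pr (∣-trans (m∣m*n (p ^ e)) p^[1+e]∣m*n)
... | inj₁ p∣m = contradiction p∣m p∤m
... | inj₂ (divides c refl) = subst (p ^ suc e ∣_) (*-comm p c) (*-monoʳ-∣ p p^e∣c)
  where
  instance
    p≢0 : NonZero p
    p≢0 = prime⇒nonZero pr
  p^e∣c : p ^ e ∣ c
  p^e∣c = p∤m⇒p^e∣m*n⇒p^e∣n {e = e} pr p∤m (*-cancelˡ-∣ p
    (subst (p ^ suc e ∣_) (trans (cong (m *_) (*-comm c p)) (x∙yz≈y∙xz m p c)) p^[1+e]∣m*n))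

p∤d⇒d*p^e∣n : Prime p → p ∤ d → d ∣ n → p ^ e ∣ n → d * p ^ e ∣ n
p∤d⇒d*p^e∣n {p} {d} {e = e} pr p∤d (divides c refl) p^e∣c*d =
  subst (d * p ^ e ∣_) (*-comm d c)
    (*-monoʳ-∣ d (p∤m⇒p^e∣m*n⇒p^e∣n {e = e} pr p∤d (subst (p ^ e ∣_) (*-comm c d) p^e∣c*d)))

m*p^e≡n*p^f⇒e≡f×m≡n : .{{NonZero p}} → p ∤ m → p ∤ n → m * p ^ e ≡ n * p ^ f → e ≡ f × m ≡ n
m*p^e≡n*p^f⇒e≡f×m≡n {p} {m} {n} {zero} {zero} _ _ eq =
  refl , trans (sym (*-identityʳ m)) (trans eq (*-identityʳ n))
m*p^e≡n*p^f⇒e≡f×m≡n {p} {m} {n} {suc e} {zero} _ p∤n eq =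
  contradiction (subst (p ∣_) (trans eq (*-identityʳ n)) (∣-trans (m∣m*n (p ^ e)) (n∣m*n m))) p∤n
m*p^e≡n*p^f⇒e≡f×m≡n {p} {m} {n} {zero} {suc f} p∤m _ eq =
  contradiction (subst (p ∣_) (trans (sym eq) (*-identityʳ m)) (∣-trans (m∣m*n (p ^ f)) (n∣m*n n))) p∤m
m*p^e≡n*p^f⇒e≡f×m≡n {p} {m} {n} {suc e} {suc f} p∤m p∤n eq
  with m*p^e≡n*p^f⇒e≡f×m≡n {e = e} {f} p∤m p∤n
         (*-cancelˡ-≡ _ _ p (trans (sym (x∙yz≈y∙xz m p (p ^ e))) (trans eq (x∙yz≈y∙xz n p (p ^ f)))))
... | refl , m≡n = refl , m≡n

m/n*[1+n]≤m⇒m≤m%n*[1+n] : ∀ m n .{{_ : NonZero n}} → m / n * suc n ≤ m → m ≤ m % n * suc n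
m/n*[1+n]≤m⇒m≤m%n*[1+n] m n le = begin
  m               ≡⟨ m≡m%n+[m/n]*n m n ⟩
  r + q * n       ≤⟨ +-monoʳ-≤ r (*-monoˡ-≤ n q≤r) ⟩
  r + r * n       ≡⟨ *-suc r n ⟨
  r * suc n       ∎
  where
  open ≤-Reasoning
  q r : ℕ
  q = m / n
  r = m % n
  q≤r : q ≤ r
  q≤r = +-cancelʳ-≤ (q * n) q r (begin
    q + q * n     ≡⟨ *-suc q n ⟨
    q * suc n     ≤⟨ le ⟩
    m             ≡⟨ m≡m%n+[m/n]*n m n ⟩
    r + q * n     ∎)

lookup-injective : ∀ {a} {A : Set a} {xs : List A} → Unique xs → Injective _≡_ _≡_ (lookup xs)
lookup-injective (_ ∷ _) {Fin.zero} {Fin.zero} _ = refl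
lookup-injective (x∉xs ∷ _) {Fin.zero} {Fin.suc j} eq = contradiction eq (All.lookup x∉xs (∈-lookup j))
lookup-injective (x∉xs ∷ _) {Fin.suc i} {Fin.zero} eq = contradiction (sym eq) (All.lookup x∉xs (∈-lookup i))
lookup-injective (_ ∷ xs!) {Fin.suc i} {Fin.suc j} eq = cong Fin.suc (lookup-injective xs! eq)

divisor : (n : ℕ) → Fin (τ n) → ℕ
divisor n = lookup (divisors n)

divisors-unique : ∀ n → Unique (divisors n)
divisors-unique n = filter⁺ (_∣? n) (applyUpTo⁺₁ suc n (λ i<j _ → <⇒≢ i<j ∘ suc-injective))

divisor-injective : ∀ n → Injective _≡_ _≡_ (divisor n)
divisor-injective n = lookup-injective (divisors-unique n)

divisor-∣ : ∀ n j → divisor n j ∣ n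
divisor-∣ n j = proj₂ (∈-filter⁻ (_∣? n) {xs = applyUpTo suc n} (∈-lookup j))

∣⇒∈divisors : .{{NonZero n}} → d ∣ n → d ∈ divisors n
∣⇒∈divisors {n} {zero}  0∣n = contradiction (0∣⇒≡0 0∣n) (≢-nonZero⁻¹ n)
∣⇒∈divisors {n} {suc d} d∣n = ∈-filter⁺ (_∣? n) (∈-applyUpTo⁺ suc (∣⇒≤ d∣n)) d∣n

divisorIndex : .{{NonZero n}} → d ∣ n → Fin (τ n)
divisorIndex d∣n = Any.index (∣⇒∈divisors d∣n)

divisor-divisorIndex : .{{_ : NonZero n}} (d∣n : d ∣ n) → divisor n (divisorIndex d∣n) ≡ d
divisor-divisorIndex d∣n = sym (lookup-index (∣⇒∈divisors d∣n))

multiplePosition : ∀ N p .{{_ : NonZero p}} → Fin (N / p) → Fin N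
multiplePosition N p k = fromℕ< (begin
  suc (pred p) + toℕ k * p   ≡⟨ cong (_+ toℕ k * p) (suc-pred p) ⟩
  suc (toℕ k) * p            ≤⟨ *-monoˡ-≤ p (toℕ<n k) ⟩
  N / p * p                  ≤⟨ m/n*n≤m N p ⟩
  N                          ∎)
  where open ≤-Reasoning

suc-toℕ-multiplePosition : ∀ N p .{{_ : NonZero p}} k →
                           suc (toℕ (multiplePosition N p k)) ≡ suc (toℕ k) * p
suc-toℕ-multiplePosition N p k =
  trans (cong suc (toℕ-fromℕ< _)) (cong (_+ toℕ k * p) (suc-pred p))

multiplePosition-injective : ∀ N p .{{_ : NonZero p}} → Injective _≡_ _≡_ (multiplePosition N p)
multiplePosition-injective N p {k} {l} eq = toℕ-injective (suc-injective (*-cancelʳ-≡ _ _ p (begin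
  suc (toℕ k) * p                        ≡⟨ suc-toℕ-multiplePosition N p k ⟨
  suc (toℕ (multiplePosition N p k))     ≡⟨ cong (suc ∘ toℕ) eq ⟩
  suc (toℕ (multiplePosition N p l))     ≡⟨ suc-toℕ-multiplePosition N p l ⟩
  suc (toℕ l) * p                        ∎)))
  where open ≡-Reasoning

DivisorsPrimeTo : ℕ → ℕ → ℕ → Set
DivisorsPrimeTo p n q = Σ (Fin q → Fin (τ n)) λ g → Injective _≡_ _≡_ g × (∀ k → p ∤ divisor n (g k))

matchable⇒divisorsPrimeTo : .{{_ : NonZero p}} → Prime p → Matchable n → DivisorsPrimeTo p n (τ n / p)
matchable⇒divisorsPrimeTo {p} {n} pr (ψ , coprime) =
  to ∘ position , multiplePosition-injective (τ n) p ∘ ↔-injective ψ , p∤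
  where
  open Inverse ψ using (to)
  position : Fin (τ n / p) → Fin (τ n)
  position = multiplePosition (τ n) p
  p∤ : ∀ k → p ∤ divisor n (to (position k))
  p∤ k p∣d = ¬prime[1] (subst Prime (gcd≡1⇒coprime (coprime (position k)) (p∣k , p∣d)) pr)
    where
    p∣k : p ∣ suc (toℕ (position k))
    p∣k = subst (p ∣_) (sym (suc-toℕ-multiplePosition (τ n) p k)) (n∣m*n (suc (toℕ k)))

divisorsPrimeTo⇒*suc≤τ : .{{_ : NonZero n}} → Prime p → p ^ e ∣ n →
                         ∀ {q} → DivisorsPrimeTo p n q → q * suc e ≤ τ n
divisorsPrimeTo⇒*suc≤τ {n} {p} {e} pr p^e∣n {q} (g , g-injective , p∤) =
  injective⇒≤ (↔-injective (*↔× {q} {suc e}) ∘ h-injective)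
  where
  instance
    p≢0 : NonZero p
    p≢0 = prime⇒nonZero pr
  δ : Fin q → ℕ
  δ k = divisor n (g k)
  δ*p^i∣n : ∀ k (i : Fin (suc e)) → δ k * p ^ toℕ i ∣ n
  δ*p^i∣n k i = p∤d⇒d*p^e∣n {e = toℕ i} pr (p∤ k) (divisor-∣ n (g k))
    (∣-trans (m≤n⇒p^m∣p^n p (≤-pred (toℕ<n i))) p^e∣n)
  h : Fin q × Fin (suc e) → Fin (τ n)
  h (k , i) = divisorIndex (δ*p^i∣n k i)
  h-injective : Injective _≡_ _≡_ h
  h-injective {k , i} {l , j} eq
    with m*p^e≡n*p^f⇒e≡f×m≡n (p∤ k) (p∤ l) (begin
      δ k * p ^ toℕ i          ≡⟨ divisor-divisorIndex (δ*p^i∣n k i) ⟨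
      divisor n (h (k , i))    ≡⟨ cong (divisor n) eq ⟩
      divisor n (h (l , j))    ≡⟨ divisor-divisorIndex (δ*p^i∣n l j) ⟩
      δ l * p ^ toℕ j          ∎)
    where open ≡-Reasoning
  ... | i≡j , δk≡δl = cong₂ _,_ (g-injective (divisor-injective n δk≡δl)) (toℕ-injective i≡j)

proposition2p1 : (n p : ℕ) → .{{_ : NonZero p}} → 0 < n → Prime p → p ^ p ∣ n →
    τ n > (τ n % p) * suc p → ¬ Matchable n
proposition2p1 n p 0<n pr p^p∣n τ>r*[1+p] matchable =
  <⇒≱ τ>r*[1+p] (m/n*[1+n]≤m⇒m≤m%n*[1+n] (τ n) p
    (divisorsPrimeTo⇒*suc≤τ pr p^p∣n (matchable⇒divisorsPrimeTo {n = n} pr matchable)))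
  where
  instance
    n≢0 : NonZero n
    n≢0 = >-nonZero 0<n
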